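{- Let $\lambda$ be a strict partition with $n$ parts and let $1\le i\le n-1$. Then \[ g^{\lambda\cup\{(i+1,i)\}}=g^\lambda_{i,i}(+1)+g^\lambda_{i+1,i+1}(+1). \]
   Context: For a strict partition $\lambda=(\lambda_1>\dots>\lambda_n>0)$, the shifted diagram is $\{(i,j):1\le i\le n,\ i\le j\le\lambda_i+i-1\}$ ($i$ = row, $j$ = column). The extended shifted diagram $\lambda\cup\{(i+1,i)\}$ is this set together with the cell in row $i+1$, column $i$. For a diagram $\pi$, a standard Young tableau of shape $\pi$ is a filling of its cells with $1,\dots,|\pi|$, each used once, increasing along rows and columns; $g^\pi$ is their number. A standard barely set-valued tableau (SBT) of shifted shape $\lambda$ is a filling with the integers $1,\dots,|\lambda|+1$, each used once, every cell containing one integer except one cell (the double cell) containing two, such that every entry of a cell is smaller than every entry of the cell to its right and of the cell below it. $g^\lambda_{i,i}(+1)$ is the number of SBTs of shape $\lambda$ whose double cell is $(i,i)$. -}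

module Defs where

open import Data.Nat using (ℕ; zero; suc; _+_; _<_; _≤_; _≟_; _<?_; _≤?_)
open import Data.Product using (_×_; _,_; proj₁; proj₂)
open import Data.Product.Properties using (≡-dec)
open import Data.Sum using (_⊎_)
open import Data.List using (List; []; _∷_; _++_; map; upTo; concatMap; zip; length; filter)
open import Data.List.Relation.Unary.All using (All; all?)
open import Data.List.Relation.Unary.Linked using (Linked)
import Data.List.Relation.Unary.Unique.DecPropositional as UniqueDec
open import Relation.Binary.PropositionalEquality using (_≡_)
open import Relation.Nullary using (Dec; yes; no)
open import Relation.Nullary.Decidable using (_×-dec_; _⊎-dec_; _→-dec_)

open UniqueDec _≟_ using (Unique; unique?)

-- Cells and diagrams (1-indexed: a cell is (row , column))

Cell : Set
Cell = ℕ × ℕ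

row col : Cell → ℕ
row = proj₁
col = proj₂

_≟c_ : (c d : Cell) → Dec (c ≡ d)
_≟c_ = ≡-dec _≟_ _≟_

Diagram : Set
Diagram = List Cell

_>_ : ℕ → ℕ → Set
m > n = n < m

StrictPartition : List ℕ → Set
StrictPartition la = Linked _>_ la × All (λ p → 0 < p) la

shiftedFrom : ℕ → List ℕ → Diagram
shiftedFrom r [] = []
shiftedFrom r (l ∷ ls) = map (λ k → (r , r + k)) (upTo l) ++ shiftedFrom (suc r) ls

-- shifted diagram {(i,j) : 1 ≤ i ≤ n, i ≤ j ≤ λᵢ + i - 1}
shifted : List ℕ → Diagram
shifted la = shiftedFrom 1 la

extended : List ℕ → ℕ → Diagram
extended la i = shifted la ++ ((suc i , i) ∷ [])

-- Fillings.  A filling of a diagram D = [c₁,...,c_k] by single entries is a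
-- list [v₁,...,v_k] of naturals (vᵢ is the entry of cell cᵢ).

Before : Cell → Cell → Set
Before c c' = (row c ≡ row c' × col c < col c') ⊎ (col c ≡ col c' × row c < row c')

before? : (c c' : Cell) → Dec (Before c c')
before? c c' = (row c ≟ row c' ×-dec col c <? col c') ⊎-dec (col c ≟ col c' ×-dec row c <? row c')

oneTo : ℕ → List ℕ
oneTo N = map suc (upTo N)

InRange : ℕ → ℕ → Set
InRange N v = 1 ≤ v × v ≤ N

inRange? : (N v : ℕ) → Dec (InRange N v)
inRange? N v = (1 ≤? v) ×-dec (v ≤? N)

allLists : ℕ → ℕ → List (List ℕ)
allLists N zero = [] ∷ []
allLists N (suc k) = concatMap (λ v → map (v ∷_) (allLists N k)) (oneTo N)

-- standard Young tableau of shape D: entries 1..|D| each used exactly once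
-- (entries in range, pairwise distinct, |D| of them), increasing along rows
-- and columns.
IsSYT : Diagram → List ℕ → Set
IsSYT D vs =
  length vs ≡ length D
  × All (InRange (length D)) vs
  × Unique vs
  × All (λ p → All (λ q → Before (proj₁ p) (proj₁ q) → proj₂ p < proj₂ q) (zip D vs)) (zip D vs)

isSYT? : (D : Diagram) (vs : List ℕ) → Dec (IsSYT D vs)
isSYT? D vs =
  (length vs ≟ length D)
  ×-dec all? (inRange? (length D)) vs
  ×-dec unique? vs
  ×-dec all? (λ p → all? (λ q → before? (proj₁ p) (proj₁ q) →-dec (proj₂ p <? proj₂ q)) (zip D vs)) (zip D vs)

g : Diagram → ℕ
g D = length (filter (isSYT? D) (allLists (length D) (length D)))

-- Standard barely set-valued tableaux with a prescribed double cell d.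
-- Such a tableau is encoded as (vs , e): vs gives one entry per cell, and the
-- double cell d additionally contains e, with (entry of d in vs) < e, so that
-- each two-element set is represented exactly once.

entries : Cell → ℕ → Cell × ℕ → List ℕ
entries d e (c , v) with c ≟c d
... | yes _ = v ∷ e ∷ []
... | no _  = v ∷ []

IsSBT : Diagram → Cell → List ℕ × ℕ → Set
IsSBT D d (vs , e) =
  length vs ≡ length D
  × All (InRange (suc (length D))) (e ∷ vs)
  × Unique (e ∷ vs)
  × All (λ p → proj₁ p ≡ d → proj₂ p < e) (zip D vs)
  × All (λ p → All (λ q → Before (proj₁ p) (proj₁ q) →
        All (λ x → All (λ y → x < y) (entries d e q)) (entries d e p)) (zip D vs)) (zip D vs)

isSBT? : (D : Diagram) (d : Cell) (t : List ℕ × ℕ) → Dec (IsSBT D d t)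
isSBT? D d (vs , e) =
  (length vs ≟ length D)
  ×-dec all? (inRange? (suc (length D))) (e ∷ vs)
  ×-dec unique? (e ∷ vs)
  ×-dec all? (λ p → (proj₁ p ≟c d) →-dec (proj₂ p <? e)) (zip D vs)
  ×-dec all? (λ p → all? (λ q → before? (proj₁ p) (proj₁ q) →-dec
        all? (λ x → all? (λ y → x <? y) (entries d e q)) (entries d e p)) (zip D vs)) (zip D vs)

sbtCandidates : Diagram → List (List ℕ × ℕ)
sbtCandidates D =
  concatMap (λ e → map (λ vs → (vs , e)) (allLists (suc (length D)) (length D)))
            (oneTo (suc (length D)))

gSBT : List ℕ → Cell → ℕ
gSBT la d = length (filter (isSBT? (shifted la) d) (sbtCandidates (shifted la)))

-- Write Z for the filling of λ given by a tableau of the extended shape with the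
-- extra cell (i+1, i) removed, e for the entry of (i+1, i), and a, b, c for the
-- entries of Z at (i, i), (i, i+1), (i+1, i+1).  In a shifted diagram the only
-- neighbours of (i+1, i) are (i, i) above and (i+1, i+1) to its right, so the
-- tableau is standard iff Z is increasing and a < e < c.  Since a < b < c and
-- e ≠ b, exactly one of two cases occurs.  If e < b, then e can be put into the
-- cell (i, i) as its second entry.  If b < e, then e can replace c, and c becomes
-- the second entry of (i+1, i+1).  Conversely, every standard barely set-valued
-- tableau with double cell (i, i) or (i+1, i+1) arises in exactly one of these
-- ways.

module Submission where

open import Defs
open import Algebra.Properties.CommutativeSemigroup using (interchange)
open import Data.Bool using (true; false)
open import Data.Empty using (⊥; ⊥-elim)
open import Data.List using (List; []; _∷_; _++_; _∷ʳ_; map; concatMap; filter; length; zip; upTo)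
open import Data.List.Membership.Propositional using (_∈_)
open import Data.List.Membership.Propositional.Properties
  using (∈-++⁺ˡ; ∈-++⁺ʳ; ∈-++⁻; ∈-insert; ∈-∃++; ∈-map⁺; ∈-map⁻; ∈-upTo⁺)
open import Data.List.Properties using (filter-++; filter-≐; length-++)
open import Data.List.Relation.Binary.Permutation.Propositional using (_↭_; ↭-sym; ↭-trans; ↭-prep; ↭⇒↭ₛ)
open import Data.List.Relation.Binary.Permutation.Propositional.Properties using (All-resp-↭; shift; ∷↭∷ʳ)
import Data.List.Relation.Binary.Permutation.Setoid.Properties as Permutationₛ
open import Data.List.Relation.Unary.All as All using (All; []; _∷_)
open import Data.List.Relation.Unary.AllPairs as AllPairs using (_∷_)
open import Data.List.Relation.Unary.Any using (here; there)
open import Data.List.Relation.Unary.Linked using (_∷_)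
open import Data.List.Relation.Unary.Unique.Propositional using (Unique)
import Data.List.Relation.Unary.Unique.Propositional.Properties as Unique
open import Data.Nat using (ℕ; zero; suc; _+_; _≤_; _<_; s≤s)
open import Data.Nat.Properties
open import Data.Product using (_×_; _,_; proj₁; proj₂; ∃; map₁; map₂; uncurry)
open import Data.Sum using (_⊎_; inj₁; inj₂; [_,_])
open import Function using (_∘_; case_of_)
open import Function.Bundles using (_⇔_; mk⇔; Equivalence)
open import Relation.Binary using (tri<; tri≈; tri>)
open import Relation.Binary.PropositionalEquality hiding ([_])
open import Relation.Nullary using (Dec; yes; no)
open import Relation.Unary using (Decidable; _≐_)
open import Relation.Unary.Properties using (_∪?_)

open Equivalence using (to; from)

-- Counting

private
  variable
    A B : Set

count : {P : A → Set} → Decidable P → List A → ℕ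
count P? xs = length (filter P? xs)

∑ : List A → (A → ℕ) → ℕ
∑ []       f = 0
∑ (x ∷ xs) f = f x + ∑ xs f

count-≐ : {P Q : A → Set} (P? : Decidable P) (Q? : Decidable Q) → P ≐ Q →
          ∀ xs → count P? xs ≡ count Q? xs
count-≐ P? Q? P≐Q xs = cong length (filter-≐ P? Q? P≐Q xs)

count-∪ : {Q R : A → Set} (Q? : Decidable Q) (R? : Decidable R) → (∀ {x} → Q x → R x → ⊥) →
          ∀ xs → count (Q? ∪? R?) xs ≡ count Q? xs + count R? xs
count-∪ Q? R? disjoint []       = refl
count-∪ Q? R? disjoint (x ∷ xs) with Q? x | R? x
... | yes q | yes r = ⊥-elim (disjoint q r)
... | yes _ | no _  = cong suc (count-∪ Q? R? disjoint xs)
... | no _  | yes _ = trans (cong suc (count-∪ Q? R? disjoint xs)) (sym (+-suc _ _))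
... | no _  | no _  = count-∪ Q? R? disjoint xs

count-++ : {P : A → Set} (P? : Decidable P) → ∀ xs ys → count P? (xs ++ ys) ≡ count P? xs + count P? ys
count-++ P? xs ys = trans (cong length (filter-++ P? xs ys)) (length-++ (filter P? xs))

count-map : {P : B → Set} (P? : Decidable P) (f : A → B) →
            ∀ xs → count P? (map f xs) ≡ count (λ x → P? (f x)) xs
count-map P? f []       = refl
count-map P? f (x ∷ xs) with Dec.does (P? (f x))
... | true  = cong suc (count-map P? f xs)
... | false = count-map P? f xs

count-[-] : {P : A → Set} {Q : B → Set} (P? : Decidable P) (Q? : Decidable Q) → ∀ {x y} →
            Dec.does (P? x) ≡ Dec.does (Q? y) → count P? (x ∷ []) ≡ count Q? (y ∷ [])
count-[-] P? Q? {x} {y} eq with Dec.does (P? x) | Dec.does (Q? y)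
... | true  | true  = refl
... | false | false = refl
... | true  | false = case eq of λ ()
... | false | true  = case eq of λ ()

count-concatMap : {P : B → Set} (P? : Decidable P) (f : A → List B) →
                  ∀ xs → count P? (concatMap f xs) ≡ ∑ xs (λ x → count P? (f x))
count-concatMap P? f []       = refl
count-concatMap P? f (x ∷ xs) =
  trans (count-++ P? (f x) (concatMap f xs)) (cong (count P? (f x) +_) (count-concatMap P? f xs))

∑-cong : ∀ xs {f h : A → ℕ} → (∀ x → f x ≡ h x) → ∑ xs f ≡ ∑ xs h
∑-cong []       f≗h = refl
∑-cong (x ∷ xs) f≗h = cong₂ _+_ (f≗h x) (∑-cong xs f≗h)

∑-+ : ∀ xs (f h : A → ℕ) → ∑ xs (λ x → f x + h x) ≡ ∑ xs f + ∑ xs h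
∑-+ []       f h = refl
∑-+ (x ∷ xs) f h = trans (cong (f x + h x +_) (∑-+ xs f h))
                         (interchange +-commutativeSemigroup (f x) (h x) (∑ xs f) (∑ xs h))

∑-zero : ∀ xs → ∑ xs (λ (_ : A) → 0) ≡ 0
∑-zero []       = refl
∑-zero (x ∷ xs) = ∑-zero xs

∑-comm : (xs : List A) (ys : List B) (f : A → B → ℕ) →
         ∑ xs (λ x → ∑ ys (f x)) ≡ ∑ ys (λ y → ∑ xs (λ x → f x y))
∑-comm []       ys f = sym (∑-zero ys)
∑-comm (x ∷ xs) ys f =
  trans (cong (∑ ys (f x) +_) (∑-comm xs ys f)) (sym (∑-+ ys (f x) (λ y → ∑ xs (λ x′ → f x′ y))))

count-pairs : {P : A × B → Set} (P? : Decidable P) (L : List A) (es : List B) →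
              count P? (concatMap (λ e → map (λ vs → (vs , e)) L) es) ≡ ∑ es (λ e → count (λ vs → P? (vs , e)) L)
count-pairs P? L es = trans (count-concatMap P? _ es) (∑-cong es λ e → count-map P? (λ vs → (vs , e)) L)

swapAt : ℕ → List ℕ → ℕ → List ℕ × ℕ
swapAt p       []       e = [] , e
swapAt zero    (v ∷ vs) e = e ∷ vs , v
swapAt (suc p) (v ∷ vs) e = map₁ (v ∷_) (swapAt p vs e)

length-swapAt : ∀ p vs e → length (proj₁ (swapAt p vs e)) ≡ length vs
length-swapAt p       []       e = refl
length-swapAt zero    (v ∷ vs) e = refl
length-swapAt (suc p) (v ∷ vs) e = cong suc (length-swapAt p vs e)

swapAt-++ : ∀ vs₁ {p c vs₂ e} → length vs₁ ≡ p → swapAt p (vs₁ ++ c ∷ vs₂) e ≡ (vs₁ ++ e ∷ vs₂ , c)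
swapAt-++ []        refl = refl
swapAt-++ (v ∷ vs₁) refl = cong (map₁ (v ∷_)) (swapAt-++ vs₁ refl)

module _ (N : ℕ) where

  private
    ∑∑ : (ℕ → ℕ → ℕ) → ℕ
    ∑∑ f = ∑ (oneTo N) λ v → ∑ (oneTo N) (f v)

  count-allLists-suc : ∀ k {P : List ℕ → Set} (P? : Decidable P) →
    count P? (allLists N (suc k)) ≡ ∑ (oneTo N) λ v → count (λ vs → P? (v ∷ vs)) (allLists N k)
  count-allLists-suc k P? =
    trans (count-concatMap P? _ (oneTo N)) (∑-cong (oneTo N) λ v → count-map P? (v ∷_) (allLists N k))

  count-allLists-∷ʳ : ∀ k {P : List ℕ → Set} (P? : Decidable P) →
    count P? (allLists N (suc k)) ≡ ∑ (oneTo N) λ e → count (λ vs → P? (vs ∷ʳ e)) (allLists N k)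
  count-allLists-∷ʳ zero    P? = trans (count-allLists-suc zero P?)
    (∑-cong (oneTo N) λ v → count-[-] (λ vs → P? (v ∷ vs)) (λ vs → P? (vs ∷ʳ v)) refl)
  count-allLists-∷ʳ (suc k) P? = begin
    count P? (allLists N (suc (suc k)))
      ≡⟨ count-allLists-suc (suc k) P? ⟩
    ∑ (oneTo N) (λ v → count (λ vs → P? (v ∷ vs)) (allLists N (suc k)))
      ≡⟨ ∑-cong (oneTo N) (λ v → count-allLists-∷ʳ k (λ vs → P? (v ∷ vs))) ⟩
    ∑∑ (λ v e → count (λ vs → P? (v ∷ vs ∷ʳ e)) (allLists N k))
      ≡⟨ ∑-comm (oneTo N) (oneTo N) _ ⟩
    ∑∑ (λ e v → count (λ vs → P? (v ∷ vs ∷ʳ e)) (allLists N k))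
      ≡⟨ ∑-cong (oneTo N) (λ e → count-allLists-suc k (λ vs → P? (vs ∷ʳ e))) ⟨
    ∑ (oneTo N) (λ e → count (λ vs → P? (vs ∷ʳ e)) (allLists N (suc k)))
      ∎
    where open ≡-Reasoning

  ∑-count-pairs-suc : ∀ k {P : List ℕ × ℕ → Set} (P? : Decidable P) →
    ∑ (oneTo N) (λ e → count (λ vs → P? (vs , e)) (allLists N (suc k))) ≡
    ∑∑ (λ v e → count (λ vs → P? (v ∷ vs , e)) (allLists N k))
  ∑-count-pairs-suc k P? =
    trans (∑-cong (oneTo N) (λ e → count-allLists-suc k (λ vs → P? (vs , e)))) (∑-comm (oneTo N) (oneTo N) _)

  ∑-count-swapAt : ∀ k p {P : List ℕ × ℕ → Set} (P? : Decidable P) →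
    ∑ (oneTo N) (λ e → count (λ vs → P? (vs , e)) (allLists N k)) ≡
    ∑ (oneTo N) (λ e → count (λ vs → P? (swapAt p vs e)) (allLists N k))
  ∑-count-swapAt zero    p       P? =
    ∑-cong (oneTo N) λ e → count-[-] (λ vs → P? (vs , e)) (λ vs → P? (swapAt p vs e)) refl
  ∑-count-swapAt (suc k) zero    P? =
    trans (∑-count-pairs-suc k P?)
          (trans (∑-comm (oneTo N) (oneTo N) _) (sym (∑-count-pairs-suc k (P? ∘ uncurry (swapAt zero)))))
  ∑-count-swapAt (suc k) (suc p) P? =
    trans (∑-count-pairs-suc k P?)
          (trans (∑-cong (oneTo N) λ v → ∑-count-swapAt k p (P? ∘ map₁ (v ∷_)))
                 (sym (∑-count-pairs-suc k (P? ∘ uncurry (swapAt (suc p))))))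

-- Fillings

Filling : Set
Filling = List (Cell × ℕ)

Increasing : Filling → Set
Increasing Z = ∀ {x y u v} → (x , u) ∈ Z → (y , v) ∈ Z → Before x y → u < v

Functional : List (A × B) → Set
Functional Z = ∀ {x u v} → (x , u) ∈ Z → (x , v) ∈ Z → u ≡ v

-- e can be added to the entry of the cell d of Z as its larger second entry.
Joinable : Filling → Cell → ℕ → Set
Joinable Z d e = (∀ {v} → (d , v) ∈ Z → v < e)
               × (∀ {u y v} → (d , u) ∈ Z → (y , v) ∈ Z → Before d y → e < v)

SetValuedIncreasing : Cell → ℕ → Filling → Set
SetValuedIncreasing d e Z =
  All (λ p → proj₁ p ≡ d → proj₂ p < e) Z ×
  All (λ p → All (λ q → Before (proj₁ p) (proj₁ q) →
        All (λ x → All (λ y → x < y) (entries d e q)) (entries d e p)) Z) Z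

DistinctIn : ℕ → List ℕ → Set
DistinctIn N ws = All (InRange N) ws × Unique ws

DistinctIn-↭ : ∀ {N ws ws′} → ws ↭ ws′ → DistinctIn N ws → DistinctIn N ws′
DistinctIn-↭ p (inRange , unique) =
  All-resp-↭ p inRange , Permutationₛ.Unique-resp-↭ (setoid ℕ) (↭⇒↭ₛ p) unique

Before-irrefl : ∀ {x} → Before x x → ⊥
Before-irrefl (inj₁ (_ , lt)) = <-irrefl refl lt
Before-irrefl (inj₂ (_ , lt)) = <-irrefl refl lt

Before-suc-col : ∀ {r k} → Before (r , k) (r , suc k)
Before-suc-col {k = k} = inj₁ (refl , n<1+n k)

Before-suc-row : ∀ {r k} → Before (r , k) (suc r , k)
Before-suc-row {r} = inj₂ (refl , n<1+n r)

module _ {d : Cell} {e : ℕ} {P : ℕ → Set} where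

  All-entries⁻ : ∀ {x v} → All P (entries d e (x , v)) → P v × (x ≡ d → P e)
  All-entries⁻ {x} all with x ≟c d
  All-entries⁻ (pv ∷ pe ∷ []) | yes _   = pv , λ _ → pe
  All-entries⁻ (pv ∷ [])      | no x≢d = pv , λ x≡d → ⊥-elim (x≢d x≡d)

  All-entries⁺ : ∀ {x v} → P v → (x ≡ d → P e) → All P (entries d e (x , v))
  All-entries⁺ {x} pv pe with x ≟c d
  ... | yes x≡d = pv ∷ pe x≡d ∷ []
  ... | no _    = pv ∷ []

All²⇔ : {R : A → A → Set} {xs : List A} →
        All (λ p → All (R p) xs) xs ⇔ (∀ {p q} → p ∈ xs → q ∈ xs → R p q)
All²⇔ = mk⇔ (λ all {_} {_} p q → All.lookup (All.lookup all p) q)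
            (λ R′ → All.tabulate λ p → All.tabulate λ q → R′ p q)

SetValuedIncreasing⇔ : ∀ {d e Z} → SetValuedIncreasing d e Z ⇔ (Increasing Z × Joinable Z d e)
SetValuedIncreasing⇔ {d} {e} {Z} = mk⇔ to′ from′
  where
  to′ : SetValuedIncreasing d e Z → Increasing Z × Joinable Z d e
  to′ (below , ordered) = increasing , (λ p → All.lookup below p refl) , above
    where
    increasing : Increasing Z
    increasing p q lt = proj₁ (All-entries⁻ (proj₁ (All-entries⁻ (to All²⇔ ordered p q lt))))
    above : ∀ {u y v} → (d , u) ∈ Z → (y , v) ∈ Z → Before d y → e < v
    above p q lt = proj₁ (All-entries⁻ (proj₂ (All-entries⁻ (to All²⇔ ordered p q lt)) refl))

  from′ : Increasing Z × Joinable Z d e → SetValuedIncreasing d e Z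
  from′ (increasing , below , above) =
    All.tabulate (λ { {_ , _} p refl → below p }) ,
    from All²⇔ λ { {_ , _} {_ , _} p q lt →
      All-entries⁺ (All-entries⁺ (increasing p q lt) λ { refl → <-trans (increasing p q lt) (below q) })
                   λ { refl → All-entries⁺ (above p q lt) λ { refl → ⊥-elim (Before-irrefl lt) } } }

module _ {A B : Set} where

  ∈-zip⁻ˡ : ∀ {xs : List A} {ys : List B} {x y} → (x , y) ∈ zip xs ys → x ∈ xs
  ∈-zip⁻ˡ {_ ∷ _} {_ ∷ _} (here refl) = here refl
  ∈-zip⁻ˡ {_ ∷ _} {_ ∷ _} (there p)   = there (∈-zip⁻ˡ p)

  ∈-zip⁻ʳ : ∀ {xs : List A} {ys : List B} {x y} → (x , y) ∈ zip xs ys → y ∈ ys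
  ∈-zip⁻ʳ {_ ∷ _} {_ ∷ _} (here refl) = here refl
  ∈-zip⁻ʳ {_ ∷ _} {_ ∷ _} (there p)   = there (∈-zip⁻ʳ p)

  ∈-zip⁺ : ∀ {xs : List A} {ys : List B} {x} → x ∈ xs → length ys ≡ length xs → ∃ λ y → (x , y) ∈ zip xs ys
  ∈-zip⁺ {_ ∷ _} {y ∷ _} (here refl) _   = y , here refl
  ∈-zip⁺ {_ ∷ _} {_ ∷ _} (there p)   len = map₂ there (∈-zip⁺ p (suc-injective len))

  zip-functional : ∀ {xs : List A} {ys : List B} → Unique xs → Functional (zip xs ys)
  zip-functional {_ ∷ _} {_ ∷ _} _            (here refl) (here refl) = refl
  zip-functional {_ ∷ _} {_ ∷ _} (x∉ ∷ _)     (here refl) (there q)   = ⊥-elim (All.lookup x∉ (∈-zip⁻ˡ q) refl)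
  zip-functional {_ ∷ _} {_ ∷ _} (x∉ ∷ _)     (there p)   (here refl) = ⊥-elim (All.lookup x∉ (∈-zip⁻ˡ p) refl)
  zip-functional {_ ∷ _} {_ ∷ _} (_ ∷ unique) (there p)   (there q)   = zip-functional unique p q

  zip-++ : ∀ (xs : List A) {ys : List B} {xs′ ys′} → length xs ≡ length ys →
           zip (xs ++ xs′) (ys ++ ys′) ≡ zip xs ys ++ zip xs′ ys′
  zip-++ []       {[]}     len = refl
  zip-++ (x ∷ xs) {y ∷ ys} len = cong ((x , y) ∷_) (zip-++ xs (suc-injective len))

  split-like : ∀ (xs₁ : List A) {x xs₂} (ys : List B) → length ys ≡ length (xs₁ ++ x ∷ xs₂) →
    ∃ λ ys₁ → ∃ λ y → ∃ λ ys₂ →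
      ys ≡ ys₁ ++ y ∷ ys₂ × length ys₁ ≡ length xs₁ × length ys₂ ≡ length xs₂
  split-like []        (y ∷ ys) len = [] , y , ys , refl , refl , suc-injective len
  split-like (_ ∷ xs₁) (y ∷ ys) len with split-like xs₁ ys (suc-injective len)
  ... | ys₁ , y′ , ys₂ , refl , len₁ , len₂ = y ∷ ys₁ , y′ , ys₂ , refl , cong suc len₁ , len₂

length-∷ʳ : (xs : List A) {x : A} → length (xs ∷ʳ x) ≡ suc (length xs)
length-∷ʳ xs = trans (length-++ xs) (+-comm (length xs) 1)

IsSYT-∷ʳ⇔ : ∀ {D x vs e Z} → zip D vs ≡ Z → length vs ≡ length D →
  IsSYT (D ∷ʳ x) (vs ∷ʳ e) ⇔ (DistinctIn (suc (length D)) (e ∷ vs) × Increasing (Z ∷ʳ (x , e)))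
IsSYT-∷ʳ⇔ {D} {x} {vs} {e} refl len = mk⇔ to′ from′
  where
  zip-∷ʳ : zip (D ∷ʳ x) (vs ∷ʳ e) ≡ zip D vs ∷ʳ (x , e)
  zip-∷ʳ = zip-++ D (sym len)

  to′ : IsSYT (D ∷ʳ x) (vs ∷ʳ e) → DistinctIn (suc (length D)) (e ∷ vs) × Increasing (zip D vs ∷ʳ (x , e))
  to′ (_ , inRange , unique , ordered) =
    DistinctIn-↭ (↭-sym (∷↭∷ʳ e vs)) (subst (λ N → All (InRange N) (vs ∷ʳ e)) (length-∷ʳ D) inRange , unique) ,
    subst Increasing zip-∷ʳ (to All²⇔ ordered)

  from′ : DistinctIn (suc (length D)) (e ∷ vs) × Increasing (zip D vs ∷ʳ (x , e)) → IsSYT (D ∷ʳ x) (vs ∷ʳ e)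
  from′ (distinct , increasing) with DistinctIn-↭ (∷↭∷ʳ e vs) distinct
  ... | inRange , unique =
    trans (length-∷ʳ vs) (trans (cong suc len) (sym (length-∷ʳ D))) ,
    subst (λ N → All (InRange N) (vs ∷ʳ e)) (sym (length-∷ʳ D)) inRange ,
    unique ,
    from All²⇔ (subst Increasing (sym zip-∷ʳ) increasing)

IsSBT⇔ : ∀ {D d vs e Z} → zip D vs ≡ Z → length vs ≡ length D →
  IsSBT D d (vs , e) ⇔ (DistinctIn (suc (length D)) (e ∷ vs) × Increasing Z × Joinable Z d e)
IsSBT⇔ refl len = mk⇔ (λ { (_ , inRange , unique , ordered) → (inRange , unique) , to SetValuedIncreasing⇔ ordered })
                      (λ { ((inRange , unique) , rest) → len , inRange , unique , from SetValuedIncreasing⇔ rest })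

-- Cells near the diagonal

Upper : Cell → Set
Upper x = row x ≤ col x

UpperCells : Filling → Set
UpperCells Z = ∀ {x v} → (x , v) ∈ Z → Upper x

_⊑_ : Cell → Cell → Set
x ⊑ y = x ≡ y ⊎ Before x y

before-⊑-above : ∀ {j k r l} → r ≤ l → k ≤ suc j → Before (r , l) (suc j , k) → (r , l) ⊑ (j , k)
before-⊑-above r≤l k≤1+j (inj₁ (refl , l<k))   = ⊥-elim (<-irrefl refl (<-≤-trans l<k (≤-trans k≤1+j r≤l)))
before-⊑-above r≤l k≤1+j (inj₂ (refl , r<1+j)) with m≤n⇒m<n∨m≡n (≤-pred r<1+j)
... | inj₁ r<j = inj₂ (inj₂ (refl , r<j))
... | inj₂ refl = inj₁ refl

after-⊒-right : ∀ {j k r l} → r ≤ l → k ≤ j → Before (j , k) (r , l) → (j , suc k) ⊑ (r , l)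
after-⊒-right r≤l k≤j (inj₁ (refl , k<l)) with m≤n⇒m<n∨m≡n k<l
... | inj₁ 1+k<l = inj₂ (inj₁ (refl , 1+k<l))
... | inj₂ refl  = inj₁ refl
after-⊒-right r≤l k≤j (inj₂ (refl , j<r)) = ⊥-elim (<-irrefl refl (<-≤-trans j<r (≤-trans r≤l k≤j)))

increasing-⊑ : ∀ {Z x y u v} → Increasing Z → Functional Z → x ⊑ y → (x , u) ∈ Z → (y , v) ∈ Z → u ≤ v
increasing-⊑ increasing functional (inj₁ refl) p q = ≤-reflexive (functional p q)
increasing-⊑ increasing functional (inj₂ lt)   p q = <⇒≤ (increasing p q lt)

module _ {i : ℕ} {Z : Filling} (functional : Functional Z) (upper : UpperCells Z) where

  increasing-∷ʳ⇔ : ∀ {a c e} → ((i , i) , a) ∈ Z → ((suc i , suc i) , c) ∈ Z →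
    Increasing (Z ∷ʳ ((suc i , i) , e)) ⇔ (Increasing Z × a < e × e < c)
  increasing-∷ʳ⇔ {a} {c} {e} a∈ c∈ = mk⇔ to′ from′
    where
    new : ((suc i , i) , e) ∈ Z ∷ʳ ((suc i , i) , e)
    new = ∈-++⁺ʳ Z (here refl)

    to′ : Increasing (Z ∷ʳ ((suc i , i) , e)) → Increasing Z × a < e × e < c
    to′ increasing = (λ p q → increasing (∈-++⁺ˡ p) (∈-++⁺ˡ q)) ,
                     increasing (∈-++⁺ˡ a∈) new Before-suc-row , increasing new (∈-++⁺ˡ c∈) Before-suc-col

    from′ : Increasing Z × a < e × e < c → Increasing (Z ∷ʳ ((suc i , i) , e))
    from′ (increasing , a<e , e<c) p q lt with ∈-++⁻ Z p | ∈-++⁻ Z q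
    ... | inj₁ p′        | inj₁ q′ = increasing p′ q′ lt
    ... | inj₁ p′        | inj₂ (here refl) =
      ≤-<-trans (increasing-⊑ increasing functional (before-⊑-above (upper p′) (n≤1+n i) lt) p′ a∈) a<e
    ... | inj₂ (here refl) | inj₁ q′ =
      <-≤-trans e<c (increasing-⊑ increasing functional (after-⊒-right (upper q′) (n≤1+n i) lt) c∈ q′)
    ... | inj₂ (here refl) | inj₂ (here refl) = ⊥-elim (Before-irrefl lt)

  joinable-diagonal⇔ : ∀ {a b e} → Increasing Z → ((i , i) , a) ∈ Z → ((i , suc i) , b) ∈ Z →
    Joinable Z (i , i) e ⇔ (a < e × e < b)
  joinable-diagonal⇔ {a} {b} {e} increasing a∈ b∈ =
    mk⇔ (λ (below , above) → below a∈ , above a∈ b∈ Before-suc-col)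
        (λ (a<e , e<b) → (λ p → subst (_< e) (functional a∈ p) a<e) ,
          λ _ q lt → <-≤-trans e<b (increasing-⊑ increasing functional (after-⊒-right (upper q) ≤-refl lt) b∈ q))

module _ {i : ℕ} (Z₁ Z₂ : Filling) where

  private
    with-diagonal : ℕ → Filling
    with-diagonal v = Z₁ ++ ((suc i , suc i) , v) ∷ Z₂

    ∈-insert⁻ : ∀ {p q} → p ∈ Z₁ ++ q ∷ Z₂ → p ∈ Z₁ ++ Z₂ ⊎ p ≡ q
    ∈-insert⁻ p with ∈-++⁻ Z₁ p
    ... | inj₁ p′         = inj₁ (∈-++⁺ˡ p′)
    ... | inj₂ (here eq)  = inj₂ eq
    ... | inj₂ (there p′) = inj₁ (∈-++⁺ʳ Z₁ p′)

    ∈-insert⁺ : ∀ {p q} → p ∈ Z₁ ++ Z₂ → p ∈ Z₁ ++ q ∷ Z₂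
    ∈-insert⁺ p with ∈-++⁻ Z₁ p
    ... | inj₁ p′ = ∈-++⁺ˡ p′
    ... | inj₂ p′ = ∈-++⁺ʳ Z₁ (there p′)

  replace-diagonal⇔ : ∀ {b c e} →
    (∀ {v} → Functional (with-diagonal v)) → (∀ {v} → UpperCells (with-diagonal v)) →
    ((i , suc i) , b) ∈ with-diagonal c →
    (Increasing (with-diagonal e) × Joinable (with-diagonal e) (suc i , suc i) c) ⇔
    (Increasing (with-diagonal c) × b < e × e < c)
  replace-diagonal⇔ {b} {c} {e} functional upper b∈ = mk⇔ to′ from′
    where
    b∈′ : ∀ {v} → ((i , suc i) , b) ∈ with-diagonal v
    b∈′ with ∈-insert⁻ b∈
    ... | inj₁ p = ∈-insert⁺ p
    ... | inj₂ eq = ⊥-elim (<-irrefl (cong (proj₁ ∘ proj₁) eq) (n<1+n i))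

    to′ : Increasing (with-diagonal e) × Joinable (with-diagonal e) (suc i , suc i) c →
          Increasing (with-diagonal c) × b < e × e < c
    to′ (increasing , below , above) = increasing′ , b<e , e<c
      where
      e<c = below (∈-insert Z₁)
      b<e = increasing b∈′ (∈-insert Z₁) Before-suc-row
      increasing′ : Increasing (with-diagonal c)
      increasing′ p q lt with ∈-insert⁻ p | ∈-insert⁻ q
      ... | inj₁ p′   | inj₁ q′   = increasing (∈-insert⁺ p′) (∈-insert⁺ q′) lt
      ... | inj₁ p′   | inj₂ refl = <-trans (increasing (∈-insert⁺ p′) (∈-insert Z₁) lt) e<c
      ... | inj₂ refl | inj₁ q′   = above (∈-insert Z₁) (∈-insert⁺ q′) lt
      ... | inj₂ refl | inj₂ refl = ⊥-elim (Before-irrefl lt)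

    from′ : Increasing (with-diagonal c) × b < e × e < c →
            Increasing (with-diagonal e) × Joinable (with-diagonal e) (suc i , suc i) c
    from′ (increasing , b<e , e<c) = increasing′ , below , above
      where
      increasing′ : Increasing (with-diagonal e)
      increasing′ p q lt with ∈-insert⁻ p | ∈-insert⁻ q
      ... | inj₁ p′   | inj₁ q′   = increasing (∈-insert⁺ p′) (∈-insert⁺ q′) lt
      ... | inj₁ p′   | inj₂ refl =
        ≤-<-trans (increasing-⊑ increasing functional (before-⊑-above (upper p) ≤-refl lt) (∈-insert⁺ p′) b∈) b<e
      ... | inj₂ refl | inj₁ q′   = <-trans e<c (increasing (∈-insert Z₁) (∈-insert⁺ q′) lt)
      ... | inj₂ refl | inj₂ refl = ⊥-elim (Before-irrefl lt)
      below : ∀ {v} → ((suc i , suc i) , v) ∈ with-diagonal e → v < c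
      below p = subst (_< c) (functional (∈-insert Z₁) p) e<c
      above : ∀ {u y v} → ((suc i , suc i) , u) ∈ with-diagonal e → (y , v) ∈ with-diagonal e →
              Before (suc i , suc i) y → c < v
      above _ q lt with ∈-insert⁻ q
      ... | inj₁ q′   = increasing (∈-insert Z₁) (∈-insert⁺ q′) lt
      ... | inj₂ refl = ⊥-elim (Before-irrefl lt)

-- The correspondence at the corner (i+1, i)

sbtCount : Diagram → Cell → ℕ
sbtCount D d = count (isSBT? D d) (sbtCandidates D)

module Corner (i : ℕ) (D₁ D₂ : Diagram)
  (unique : Unique (D₁ ++ (suc i , suc i) ∷ D₂))
  (upper : ∀ {x} → x ∈ D₁ ++ (suc i , suc i) ∷ D₂ → Upper x)
  (diagonal∈ : (i , i) ∈ D₁ ++ (suc i , suc i) ∷ D₂)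
  (right∈ : (i , suc i) ∈ D₁ ++ (suc i , suc i) ∷ D₂)
  where

  D : Diagram
  D = D₁ ++ (suc i , suc i) ∷ D₂

  E : Diagram
  E = D ∷ʳ (suc i , i)

  module Values {vs₁ vs₂ : List ℕ} (len₁ : length vs₁ ≡ length D₁) (len₂ : length vs₂ ≡ length D₂)
                (c e : ℕ) where

    vs : List ℕ
    vs = vs₁ ++ c ∷ vs₂

    filling : ℕ → Filling
    filling v = zip D₁ vs₁ ++ ((suc i , suc i) , v) ∷ zip D₂ vs₂

    zip-D : ∀ v → zip D (vs₁ ++ v ∷ vs₂) ≡ filling v
    zip-D v = zip-++ D₁ (sym len₁)

    length-vs : ∀ v → length (vs₁ ++ v ∷ vs₂) ≡ length D
    length-vs v = trans (length-++ vs₁) (trans (cong₂ (λ m n → m + suc n) len₁ len₂) (sym (length-++ D₁)))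

    functional : ∀ {v} → Functional (filling v)
    functional {v} = subst Functional (zip-D v) (zip-functional unique)

    upperCells : ∀ {v} → UpperCells (filling v)
    upperCells {v} p = upper (∈-zip⁻ˡ (subst (_ ∈_) (sym (zip-D v)) p))

    entry : ∀ {x} → x ∈ D → ∃ λ u → (x , u) ∈ filling c
    entry x∈ = map₂ (subst (_ ∈_) (zip-D c)) (∈-zip⁺ x∈ (length-vs c))

    a b : ℕ
    a = proj₁ (entry diagonal∈)
    b = proj₁ (entry right∈)

    a∈ : ((i , i) , a) ∈ filling c
    a∈ = proj₂ (entry diagonal∈)

    b∈ : ((i , suc i) , b) ∈ filling c
    b∈ = proj₂ (entry right∈)

    c∈ : ((suc i , suc i) , c) ∈ filling c
    c∈ = ∈-insert (zip D₁ vs₁)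

    e≢b : DistinctIn (suc (length D)) (e ∷ vs) → e ≢ b
    e≢b (_ , e∉vs ∷ _) = All.lookup e∉vs (∈-zip⁻ʳ (subst (((i , suc i) , b) ∈_) (sym (zip-D c)) b∈))

    swap↭ : e ∷ vs ↭ c ∷ vs₁ ++ e ∷ vs₂
    swap↭ = ↭-trans (shift c (e ∷ vs₁) vs₂) (↭-prep c (↭-sym (shift e vs₁ vs₂)))

    Admissible : Set
    Admissible = DistinctIn (suc (length D)) (e ∷ vs) × Increasing (filling c)

    syt⇔ : IsSYT E (vs ∷ʳ e) ⇔ (Admissible × a < e × e < c)
    syt⇔ = mk⇔ to′ from′
      where
      syt = IsSYT-∷ʳ⇔ (zip-D c) (length-vs c)
      corner = increasing-∷ʳ⇔ (functional {c}) (upperCells {c}) a∈ c∈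
      to′ : IsSYT E (vs ∷ʳ e) → Admissible × a < e × e < c
      to′ t with to syt t
      ... | distinct , increasing′ with to corner increasing′
      ...   | increasing , bounds = (distinct , increasing) , bounds
      from′ : Admissible × a < e × e < c → IsSYT E (vs ∷ʳ e)
      from′ ((distinct , increasing) , bounds) = from syt (distinct , from corner (increasing , bounds))

    sbt₁⇔ : IsSBT D (i , i) (vs , e) ⇔ (Admissible × a < e × e < b)
    sbt₁⇔ = mk⇔ to′ from′
      where
      sbt = IsSBT⇔ (zip-D c) (length-vs c)
      corner : Increasing (filling c) → Joinable (filling c) (i , i) e ⇔ (a < e × e < b)
      corner increasing = joinable-diagonal⇔ (functional {c}) (upperCells {c}) increasing a∈ b∈
      to′ : IsSBT D (i , i) (vs , e) → Admissible × a < e × e < b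
      to′ s with to sbt s
      ... | distinct , increasing , joinable = (distinct , increasing) , to (corner increasing) joinable
      from′ : Admissible × a < e × e < b → IsSBT D (i , i) (vs , e)
      from′ ((distinct , increasing) , bounds) = from sbt (distinct , increasing , from (corner increasing) bounds)

    sbt₂⇔ : IsSBT D (suc i , suc i) (vs₁ ++ e ∷ vs₂ , c) ⇔ (Admissible × b < e × e < c)
    sbt₂⇔ = mk⇔ to′ from′
      where
      sbt = IsSBT⇔ (zip-D e) (length-vs e)
      corner = replace-diagonal⇔ (zip D₁ vs₁) (zip D₂ vs₂) functional upperCells b∈
      to′ : IsSBT D (suc i , suc i) (vs₁ ++ e ∷ vs₂ , c) → Admissible × b < e × e < c
      to′ s with to sbt s
      ... | distinct , rest with to corner rest
      ...   | increasing , bounds = (DistinctIn-↭ (↭-sym swap↭) distinct , increasing) , bounds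
      from′ : Admissible × b < e × e < c → IsSBT D (suc i , suc i) (vs₁ ++ e ∷ vs₂ , c)
      from′ ((distinct , increasing) , bounds) = from sbt (DistinctIn-↭ swap↭ distinct , from corner (increasing , bounds))

    a<b : Increasing (filling c) → a < b
    a<b increasing = increasing a∈ b∈ Before-suc-col

    b<c : Increasing (filling c) → b < c
    b<c increasing = increasing b∈ c∈ Before-suc-row

    syt⇔sbt⊎sbt : IsSYT E (vs ∷ʳ e) ⇔ (IsSBT D (i , i) (vs , e) ⊎ IsSBT D (suc i , suc i) (vs₁ ++ e ∷ vs₂ , c))
    syt⇔sbt⊎sbt = mk⇔ to′ [ from′₁ , from′₂ ]
      where
      to′ : IsSYT E (vs ∷ʳ e) → IsSBT D (i , i) (vs , e) ⊎ IsSBT D (suc i , suc i) (vs₁ ++ e ∷ vs₂ , c)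
      to′ t with to syt⇔ t
      ... | admissible , a<e , e<c with <-cmp e b
      ...   | tri< e<b _ _ = inj₁ (from sbt₁⇔ (admissible , a<e , e<b))
      ...   | tri≈ _ e≡b _ = ⊥-elim (e≢b (proj₁ admissible) e≡b)
      ...   | tri> _ _ b<e = inj₂ (from sbt₂⇔ (admissible , b<e , e<c))
      from′₁ : IsSBT D (i , i) (vs , e) → IsSYT E (vs ∷ʳ e)
      from′₁ s with to sbt₁⇔ s
      ... | admissible , a<e , e<b = from syt⇔ (admissible , a<e , <-trans e<b (b<c (proj₂ admissible)))
      from′₂ : IsSBT D (suc i , suc i) (vs₁ ++ e ∷ vs₂ , c) → IsSYT E (vs ∷ʳ e)
      from′₂ s with to sbt₂⇔ s
      ... | admissible , b<e , e<c = from syt⇔ (admissible , <-trans (a<b (proj₂ admissible)) b<e , e<c)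

    sbt-disjoint : IsSBT D (i , i) (vs , e) → IsSBT D (suc i , suc i) (vs₁ ++ e ∷ vs₂ , c) → ⊥
    sbt-disjoint s₁ s₂ = <-asym (proj₂ (proj₂ (to sbt₁⇔ s₁))) (proj₁ (proj₂ (to sbt₂⇔ s₂)))

  index : ℕ
  index = length D₁

  module _ (e : ℕ) where

    Q R : List ℕ → Set
    Q vs = IsSBT D (i , i) (vs , e)
    -- swapAt index vs e puts e in place of the entry of (i+1, i+1) and returns that entry as the extra one.
    R vs = IsSBT D (suc i , suc i) (swapAt index vs e)

    syt⇔Q⊎R : ∀ vs → length vs ≡ length D → IsSYT E (vs ∷ʳ e) ⇔ (Q vs ⊎ R vs)
    syt⇔Q⊎R vs len with split-like D₁ vs len
    ... | vs₁ , c , vs₂ , refl , len₁ , len₂ rewrite swapAt-++ vs₁ {c = c} {vs₂} {e} len₁ =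
      Values.syt⇔sbt⊎sbt len₁ len₂ c e

    Q⊥R : ∀ {vs} → Q vs → R vs → ⊥
    Q⊥R {vs} q with split-like D₁ vs (proj₁ q)
    ... | vs₁ , c , vs₂ , refl , len₁ , len₂ rewrite swapAt-++ vs₁ {c = c} {vs₂} {e} len₁ =
      Values.sbt-disjoint len₁ len₂ c e q

    count-syt : ∀ L → count (λ vs → isSYT? E (vs ∷ʳ e)) L ≡
                      count (λ vs → isSBT? D (i , i) (vs , e)) L + count (λ vs → isSBT? D (suc i , suc i) (swapAt index vs e)) L
    count-syt L = trans (count-≐ _ (Q? ∪? R?) (syt⇒ , Q∪R⇒) L) (count-∪ Q? R? Q⊥R L)
      where
      Q? = λ vs → isSBT? D (i , i) (vs , e)
      R? = λ vs → isSBT? D (suc i , suc i) (swapAt index vs e)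
      syt⇒ : ∀ {vs} → IsSYT E (vs ∷ʳ e) → Q vs ⊎ R vs
      syt⇒ {vs} t = to (syt⇔Q⊎R vs (suc-injective (trans (sym (length-∷ʳ vs)) (trans (proj₁ t) (length-∷ʳ D))))) t
      Q∪R⇒ : ∀ {vs} → Q vs ⊎ R vs → IsSYT E (vs ∷ʳ e)
      Q∪R⇒ {vs} (inj₁ q) = from (syt⇔Q⊎R vs (proj₁ q)) (inj₁ q)
      Q∪R⇒ {vs} (inj₂ r) = from (syt⇔Q⊎R vs (trans (sym (length-swapAt index vs e)) (proj₁ r))) (inj₂ r)

  g-corner : g E ≡ sbtCount D (i , i) + sbtCount D (suc i , suc i)
  g-corner = begin
    g E
      ≡⟨ cong (λ n → count (isSYT? E) (allLists n n)) (length-∷ʳ D) ⟩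
    count (isSYT? E) (allLists N (suc k))
      ≡⟨ count-allLists-∷ʳ N k (isSYT? E) ⟩
    ∑ es (λ e → count (λ vs → isSYT? E (vs ∷ʳ e)) L)
      ≡⟨ ∑-cong es (λ e → count-syt e L) ⟩
    ∑ es (λ e → sbts (i , i) _,_ e + sbts (suc i , suc i) (swapAt index) e)
      ≡⟨ ∑-+ es (sbts (i , i) _,_) (sbts (suc i , suc i) (swapAt index)) ⟩
    ∑ es (sbts (i , i) _,_) + ∑ es (sbts (suc i , suc i) (swapAt index))
      ≡⟨ cong (∑ es (sbts (i , i) _,_) +_) (∑-count-swapAt N k index (isSBT? D (suc i , suc i))) ⟨
    ∑ es (sbts (i , i) _,_) + ∑ es (sbts (suc i , suc i) _,_)
      ≡⟨ cong₂ _+_ (count-pairs (isSBT? D (i , i)) L es) (count-pairs (isSBT? D (suc i , suc i)) L es) ⟨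
    sbtCount D (i , i) + sbtCount D (suc i , suc i)
      ∎
    where
    open ≡-Reasoning
    k = length D
    N = suc k
    es = oneTo N
    L = allLists N k
    sbts : Cell → (List ℕ → ℕ → List ℕ × ℕ) → ℕ → ℕ
    sbts d f e = count (λ vs → isSBT? D d (f vs e)) L

g-∷ʳ-corner : ∀ i {D} → Unique D → (∀ {x} → x ∈ D → Upper x) →
  (i , i) ∈ D → (i , suc i) ∈ D → (suc i , suc i) ∈ D →
  g (D ∷ʳ (suc i , i)) ≡ sbtCount D (i , i) + sbtCount D (suc i , suc i)
g-∷ʳ-corner i unique upper diagonal∈ right∈ next∈ with ∈-∃++ next∈
... | D₁ , D₂ , refl = Corner.g-corner i D₁ D₂ unique upper diagonal∈ right∈

-- Shifted diagrams

part : List ℕ → ℕ → ℕ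
part []       j       = 0
part (l ∷ ls) zero    = l
part (l ∷ ls) (suc j) = part ls j

shiftedFrom-bounds : ∀ r la {x} → x ∈ shiftedFrom r la → r ≤ row x × Upper x
shiftedFrom-bounds r (l ∷ ls) x∈ with ∈-++⁻ (map (λ k → (r , r + k)) (upTo l)) x∈
... | inj₁ x∈row with ∈-map⁻ (λ k → (r , r + k)) x∈row
...   | k , _ , refl = ≤-refl , m≤m+n r k
shiftedFrom-bounds r (l ∷ ls) x∈ | inj₂ x∈rest =
  map₁ (≤-trans (n≤1+n r)) (shiftedFrom-bounds (suc r) ls x∈rest)

shiftedFrom-unique : ∀ r la → Unique (shiftedFrom r la)
shiftedFrom-unique r []       = AllPairs.[]
shiftedFrom-unique r (l ∷ ls) =
  Unique.++⁺ (Unique.map⁺ (λ eq → +-cancelˡ-≡ r _ _ (cong proj₂ eq)) (Unique.upTo⁺ l))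
             (shiftedFrom-unique (suc r) ls)
             λ (x∈row , x∈rest) → row-disjoint x∈row x∈rest
  where
  row-disjoint : ∀ {x} → x ∈ map (λ k → (r , r + k)) (upTo l) → x ∈ shiftedFrom (suc r) ls → ⊥
  row-disjoint x∈row x∈rest with ∈-map⁻ (λ k → (r , r + k)) x∈row
  ... | _ , _ , refl = <-irrefl refl (proj₁ (shiftedFrom-bounds (suc r) ls x∈rest))

∈-shiftedFrom : ∀ r la j k → k < part la j → (r + j , k + (r + j)) ∈ shiftedFrom r la
∈-shiftedFrom r (l ∷ ls) zero    k k<l rewrite +-identityʳ r | +-comm k r =
  ∈-++⁺ˡ (∈-map⁺ (λ k → (r , r + k)) (∈-upTo⁺ k<l))
∈-shiftedFrom r (l ∷ ls) (suc j) k k<l rewrite +-suc r j =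
  ∈-++⁺ʳ _ (∈-shiftedFrom (suc r) ls j k k<l)

parts-around : ∀ la j → StrictPartition la → suc j < length la → 1 < part la j × 0 < part la (suc j)
parts-around (a ∷ b ∷ ls) zero    (b<a ∷ _ , _ ∷ 0<b ∷ _)      _        = ≤-<-trans 0<b b<a , 0<b
parts-around (a ∷ b ∷ ls) (suc j) (_ ∷ linked , _ ∷ positive) (s≤s j<) = parts-around (b ∷ ls) j (linked , positive) j<
parts-around (a ∷ [])     j       _                             (s≤s ())

lemma3p3 : (la : List ℕ) → StrictPartition la → (i : ℕ) → 1 ≤ i → i < length la →
    g (extended la i) ≡ gSBT la (i , i) + gSBT la (suc i , suc i)
lemma3p3 la sp (suc j) _ i<n with parts-around la j sp i<n
... | 1<λᵢ , 0<λᵢ₊₁ =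
  g-∷ʳ-corner (suc j) (shiftedFrom-unique 1 la) (proj₂ ∘ shiftedFrom-bounds 1 la)
    (∈-shiftedFrom 1 la j 0 (<⇒≤ 1<λᵢ)) (∈-shiftedFrom 1 la j 1 1<λᵢ) (∈-shiftedFrom 1 la (suc j) 0 0<λᵢ₊₁)
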